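{- Let $1\le k<n$, let $b=b_{k+1}\ldots b_n$ be an admissible suffix in $A_n$, and let $x\in\alpha_A(b)$. Then $\mu_A(xb)=x$ if $x\ge\mu_A(b)$; $\mu_A(xb)=\mu_A(b)$ if $b_{k+1}\le x<\mu_A(b)$; and $\mu_A(xb)=\mu_A(b)-1$ if $x<b_{k+1}$.
   Context: For a sequence $s_1\ldots s_m$, $\mathrm{asc}(s_1\ldots s_m)=\#\{i<m: s_i<s_{i+1}\}$. $A_n$ is the set of sequences $s_1\ldots s_n$ of non-negative integers with $s_1=0$ and $0\le s_{k+1}\le\mathrm{asc}(s_1\ldots s_k)+1$ for $1\le k<n$. A word $b=b_{j+1}\ldots b_n$ is an admissible suffix in $A_n$ if some sequence of $A_n$ ends with $b$. For such $b$ (with $1\le j<n$): $\alpha_A(b)=\{x : xb \text{ is an admissible suffix in } A_n\}$, and $\mu_A(b)=\min\{\mathrm{asc}(s_1\ldots s_jb_{j+1}) : s_1\ldots s_jb\in A_n\}$. -}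

module Defs where

open import Data.Nat using (ℕ; zero; suc; _+_; _≤_; _<?_)
open import Data.List using (List; []; _∷_; _++_; length; take)
open import Data.Product using (Σ; _×_; ∃)
open import Relation.Nullary using (yes; no)
open import Relation.Binary.PropositionalEquality using (_≡_)

ascStep : ℕ → ℕ → ℕ
ascStep x y with x <? y
... | yes _ = 1
... | no  _ = 0

asc : List ℕ → ℕ
asc [] = 0
asc (x ∷ []) = 0
asc (x ∷ y ∷ r) = ascStep x y + asc (y ∷ r)

-- s ∈ A_n : length n, s₁ = 0, and s_{k+1} ≤ asc(s₁…s_k) + 1 for 1 ≤ k < n.
-- Written position-wise: whenever s = p ++ x ∷ r, if p is empty then x = 0,
-- otherwise x ≤ asc p + 1.
InA : ℕ → List ℕ → Set
InA n s = (length s ≡ n) ×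
  (∀ (p : List ℕ) (x : ℕ) (r : List ℕ) → s ≡ p ++ (x ∷ r) → FirstCond p x)
  where
  FirstCond : List ℕ → ℕ → Set
  FirstCond [] x = x ≡ 0
  FirstCond (y ∷ p) x = x ≤ suc (asc (y ∷ p))

Admissible : ℕ → List ℕ → Set
Admissible n b = ∃ λ (p : List ℕ) → InA n (p ++ b)

InAlpha : ℕ → List ℕ → ℕ → Set
InAlpha n b x = Admissible n (x ∷ b)

-- a ∈ { asc(s₁…s_j b_{j+1}) : s₁…s_j b ∈ A_n }   (j = n - length b)
AscValue : ℕ → List ℕ → ℕ → Set
AscValue n b a = ∃ λ (p : List ℕ) → InA n (p ++ b) × (asc (p ++ take 1 b) ≡ a)

IsMu : ℕ → List ℕ → ℕ → Set
IsMu n b m = AscValue n b m × (∀ a → AscValue n b a → m ≤ a)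

module Submission where

-- The membership condition of A_n is a left-to-right check whose state
-- after a prefix is just (number of ascents, last entry).  Hence a suffix
-- y r can follow a prefix p ++ [ y ] exactly when  Legal (asc (p ++ [ y ])) y r,
-- and the pairs (last entry y, ascents a) realised by valid prefixes p ++ [ y ]
-- with |p| = j are exactly the "attainable" ones:
--     y ≤ a ≤ j   and   (y = a  or  a < j).
-- This gives a closed description of the junction values of a suffix
-- (ascValue⇒ / ascValue⇐), from which μ_A(b) exists as a least element of a
-- decidable nonempty set.  For the theorem, with s = ascStep x b₁, every
-- junction value v of x b yields the junction value v + s of b; conversely
-- every w between x and a known value c₁ of x b with μ_A(b) ≤ w + s is a
-- junction value of x b.  The three cases of the proposition are then
-- x (for s arbitrary), μ_A(b) (for s = 0) and μ_A(b) ∸ 1 (for s = 1).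

open import Defs
open import Data.Nat using (ℕ; zero; suc; _+_; _∸_; _≤_; _<_; z≤n; s≤s; _<?_; _≤?_; _≟_)
open import Data.Nat.Properties
open import Data.List using (List; []; _∷_; _++_; length; [_])
open import Data.List.Properties using (++-assoc; length-++)
open import Data.Product using (_×_; _,_; proj₁; proj₂; ∃)
open import Data.Sum using (_⊎_; inj₁; inj₂)
open import Data.Unit using (⊤; tt)
open import Data.Empty using (⊥-elim)
open import Relation.Nullary using (Dec; yes; no; ¬_)
open import Relation.Nullary.Decidable using (_×-dec_; _⊎-dec_; map′)
open import Relation.Unary using (Decidable)
open import Relation.Binary.PropositionalEquality using (_≡_; refl; sym; trans; cong; subst; subst₂)

+ascStep-< : ∀ a {y z} → y < z → a + ascStep y z ≡ suc a
+ascStep-< a {y} {z} y<z with y <? z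
... | yes _ = +-comm a 1
... | no y≮z = ⊥-elim (y≮z y<z)

+ascStep-≥ : ∀ a {y z} → z ≤ y → a + ascStep y z ≡ a
+ascStep-≥ a {y} {z} z≤y with y <? z
... | yes y<z = ⊥-elim (<⇒≱ y<z z≤y)
... | no _ = +-identityʳ a

ascStep≤1 : ∀ y z → ascStep y z ≤ 1
ascStep≤1 y z with y <? z
... | yes _ = s≤s z≤n
... | no _ = z≤n

Legal : ℕ → ℕ → List ℕ → Set
Legal a ℓ [] = ⊤
Legal a ℓ (y ∷ r) = y ≤ suc a × Legal (a + ascStep ℓ y) y r

ascAfter : ℕ → ℕ → List ℕ → ℕ
ascAfter a ℓ [] = a
ascAfter a ℓ (y ∷ r) = ascAfter (a + ascStep ℓ y) y r

ascAfter-asc : ∀ a ℓ r → ascAfter a ℓ r ≡ a + asc (ℓ ∷ r)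
ascAfter-asc a ℓ [] = sym (+-identityʳ a)
ascAfter-asc a ℓ (y ∷ r) = trans (ascAfter-asc (a + ascStep ℓ y) y r) (+-assoc a _ _)

Valid : List ℕ → Set
Valid [] = ⊤
Valid (z ∷ t) = z ≡ 0 × Legal 0 z t

legal-at : ∀ a ℓ q x r → Legal a ℓ (q ++ x ∷ r) → x ≤ suc (ascAfter a ℓ q)
legal-at a ℓ [] x r (x≤ , _) = x≤
legal-at a ℓ (y ∷ q) x r (_ , g) = legal-at (a + ascStep ℓ y) y q x r g

legal-from-positions : ∀ a ℓ t →
  (∀ q x r → t ≡ q ++ x ∷ r → x ≤ suc (ascAfter a ℓ q)) → Legal a ℓ t
legal-from-positions a ℓ [] _ = tt
legal-from-positions a ℓ (y ∷ t) H =
  H [] y t refl ,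
  legal-from-positions (a + ascStep ℓ y) y t (λ q x r eq → H (y ∷ q) x r (cong (y ∷_) eq))

valid⇒InA : ∀ n s → length s ≡ n → Valid s → InA n s
valid⇒InA n s len v = len , λ { [] x r refl → proj₁ v
                              ; (y ∷ p) x r refl → subst (λ a → x ≤ suc a) (ascAfter-asc 0 y p)
                                                     (legal-at 0 y p x r (proj₂ v)) }

InA⇒valid : ∀ n s → InA n s → Valid s
InA⇒valid n [] _ = tt
InA⇒valid n (z ∷ t) (_ , h) =
  h [] z t refl ,
  legal-from-positions 0 z t (λ q x r eq → subst (λ a → x ≤ suc a) (sym (ascAfter-asc 0 z q))
                                                   (h (z ∷ q) x r (cong (z ∷_) eq)))

legal-split : ∀ a ℓ q y r → Legal a ℓ (q ++ y ∷ r) →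
  Legal a ℓ (q ++ [ y ]) × Legal (ascAfter a ℓ (q ++ [ y ])) y r
legal-split a ℓ [] y r (y≤ , g) = (y≤ , tt) , g
legal-split a ℓ (z ∷ q) y r (z≤ , g) =
  let (g₁ , g₂) = legal-split (a + ascStep ℓ z) z q y r g in (z≤ , g₁) , g₂

legal-join : ∀ a ℓ q y r → Legal a ℓ (q ++ [ y ]) →
  Legal (ascAfter a ℓ (q ++ [ y ])) y r → Legal a ℓ (q ++ y ∷ r)
legal-join a ℓ [] y r (y≤ , _) g = y≤ , g
legal-join a ℓ (z ∷ q) y r (z≤ , g₁) g₂ = z≤ , legal-join (a + ascStep ℓ z) z q y r g₁ g₂

valid-split : ∀ p y r → Valid (p ++ y ∷ r) →
  Valid (p ++ [ y ]) × Legal (asc (p ++ [ y ])) y r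
valid-split [] y r (y≡0 , g) = (y≡0 , tt) , g
valid-split (z ∷ p) y r (z≡0 , g) =
  let (g₁ , g₂) = legal-split 0 z p y r g
  in (z≡0 , g₁) , subst (λ a → Legal a y r) (ascAfter-asc 0 z (p ++ [ y ])) g₂

valid-join : ∀ p y r → Valid (p ++ [ y ]) →
  Legal (asc (p ++ [ y ])) y r → Valid (p ++ y ∷ r)
valid-join [] y r (y≡0 , _) g = y≡0 , g
valid-join (z ∷ p) y r (z≡0 , g₁) g₂ =
  z≡0 , legal-join 0 z p y r g₁ (subst (λ a → Legal a y r) (sym (ascAfter-asc 0 z (p ++ [ y ]))) g₂)

legal-mono : ∀ {a a′ ℓ} r → a ≤ a′ → Legal a ℓ r → Legal a′ ℓ r
legal-mono [] _ _ = tt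
legal-mono {ℓ = ℓ} (y ∷ r) a≤a′ (y≤ , g) =
  ≤-trans y≤ (s≤s a≤a′) , legal-mono r (+-monoˡ-≤ (ascStep ℓ y) a≤a′) g

legal? : ∀ a ℓ r → Dec (Legal a ℓ r)
legal? a ℓ [] = yes tt
legal? a ℓ (y ∷ r) = y ≤? suc a ×-dec legal? (a + ascStep ℓ y) y r

asc-snoc : ∀ p y z → asc ((p ++ [ y ]) ++ [ z ]) ≡ asc (p ++ [ y ]) + ascStep y z
asc-snoc [] y z = +-identityʳ (ascStep y z)
asc-snoc (w ∷ []) y z =
  trans (cong (ascStep w y +_) (+-identityʳ (ascStep y z)))
        (cong (_+ ascStep y z) (sym (+-identityʳ (ascStep w y))))
asc-snoc (w ∷ w′ ∷ p) y z =
  trans (cong (ascStep w w′ +_) (asc-snoc (w′ ∷ p) y z)) (sym (+-assoc (ascStep w w′) _ _))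

-- Attainable j y a: a valid sequence of length j + 1 may end in y with a
-- ascents.  The ascents never exceed j, the last entry never exceeds the
-- ascents, and it equals them when every step was an ascent.
Attainable : ℕ → ℕ → ℕ → Set
Attainable j y a = y ≤ a × a ≤ j × (y ≡ a ⊎ a < j)

attainable? : ∀ j y a → Dec (Attainable j y a)
attainable? j y a = y ≤? a ×-dec a ≤? j ×-dec (y ≟ a ⊎-dec a <? j)

attainable-step : ∀ {j y a} z → Attainable j y a → z ≤ suc a →
  Attainable (suc j) z (a + ascStep y z)
attainable-step {j} {y} {a} z (y≤a , a≤j , top) z≤1+a with <-≤-connex y z
... | inj₁ y<z = subst (Attainable (suc j) z) (sym (+ascStep-< a y<z))
                  (z≤1+a , s≤s a≤j , new-top top)
  where
  new-top : y ≡ a ⊎ a < j → z ≡ suc a ⊎ suc a < suc j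
  new-top (inj₁ refl) = inj₁ (≤-antisym z≤1+a y<z)
  new-top (inj₂ a<j) = inj₂ (s≤s a<j)
... | inj₂ z≤y = subst (Attainable (suc j) z) (sym (+ascStep-≥ a z≤y))
                 (≤-trans z≤y y≤a , m≤n⇒m≤1+n a≤j , inj₂ (s≤s a≤j))

attainable-below : ∀ {j y c w} → Attainable j y c → y ≤ w → w ≤ c → Attainable j y w
attainable-below (_ , c≤j , inj₁ refl) y≤w w≤c = y≤w , ≤-trans w≤c c≤j , inj₁ (≤-antisym y≤w w≤c)
attainable-below (_ , _ , inj₂ c<j) y≤w w≤c = y≤w , <⇒≤ (≤-<-trans w≤c c<j) , inj₂ (≤-<-trans w≤c c<j)

legal-attainable : ∀ {j a ℓ} q y → Attainable j ℓ a → Legal a ℓ (q ++ [ y ]) →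
  Attainable (suc (length q) + j) y (ascAfter a ℓ (q ++ [ y ]))
legal-attainable [] y att (y≤ , _) = attainable-step y att y≤
legal-attainable {j} {a} {ℓ} (z ∷ q) y att (z≤ , g) =
  subst (λ i → Attainable i y (ascAfter (a + ascStep ℓ z) z (q ++ [ y ])))
        (cong suc (+-suc (length q) j))
        (legal-attainable q y (attainable-step z att z≤) g)

Reachable : ℕ → ℕ → ℕ → Set
Reachable j y a = ∃ λ p → length p ≡ j × Valid (p ++ [ y ]) × asc (p ++ [ y ]) ≡ a

reachable⇒attainable : ∀ p y → Valid (p ++ [ y ]) → Attainable (length p) y (asc (p ++ [ y ]))
reachable⇒attainable [] y (refl , _) = z≤n , z≤n , inj₁ refl
reachable⇒attainable (z ∷ p) y (refl , g) =
  subst₂ (λ j a → Attainable j y a) (cong suc (+-identityʳ (length p))) (ascAfter-asc 0 0 (p ++ [ y ]))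
         (legal-attainable p y (z≤n , z≤n , inj₁ refl) g)

reachable-extend : ∀ {j y a} z → Reachable j y a → z ≤ suc a →
  Reachable (suc j) z (a + ascStep y z)
reachable-extend {y = y} z (p , refl , v , refl) z≤ =
  p ++ [ y ] ,
  trans (length-++ p) (+-comm (length p) 1) ,
  subst Valid (sym (++-assoc p [ y ] [ z ])) (valid-join p y [ z ] v (z≤ , tt)) ,
  asc-snoc p y z

-- Conversely every attainable configuration is realised, by induction on j:
-- if a ≤ j, append y to a prefix ending in a with a ascents (no new ascent);
-- if a = j + 1 = y, append j + 1 to a prefix ending in j with j ascents.
attainable⇒reachable : ∀ j {y a} → Attainable j y a → Reachable j y a
attainable⇒reachable zero (z≤n , z≤n , _) = [] , refl , (refl , tt) , refl
attainable⇒reachable (suc j) {y} {a} (y≤a , a≤1+j , top) with m≤n⇒m<n∨m≡n a≤1+j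
... | inj₁ a<1+j =
  subst (Reachable (suc j) y) (+ascStep-≥ a y≤a)
        (reachable-extend y (attainable⇒reachable j (≤-refl , ≤-pred a<1+j , inj₁ refl)) (m≤n⇒m≤1+n y≤a))
... | inj₂ refl = subst (λ z → Reachable (suc j) z (suc j)) (last-is-top top)
        (subst (Reachable (suc j) (suc j)) (+ascStep-< j ≤-refl)
               (reachable-extend (suc j) (attainable⇒reachable j (≤-refl , ≤-refl , inj₁ refl)) ≤-refl))
  where
  last-is-top : y ≡ suc j ⊎ suc j < suc j → suc j ≡ y
  last-is-top (inj₁ y≡1+j) = sym y≡1+j
  last-is-top (inj₂ 1+j<1+j) = ⊥-elim (n≮n (suc j) 1+j<1+j)

ascValue⇒ : ∀ {n y r a} j → j + length (y ∷ r) ≡ n →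
  AscValue n (y ∷ r) a → Attainable j y a × Legal a y r
ascValue⇒ {n} {y} {r} j len (p , I , refl) =
  let (v , g) = valid-split p y r (InA⇒valid n _ I) in
  subst (λ i → Attainable i y (asc (p ++ [ y ]))) length-p (reachable⇒attainable p y v) , g
  where
  length-p : length p ≡ j
  length-p = +-cancelʳ-≡ (length (y ∷ r)) (length p) j (trans (sym (length-++ p)) (trans (proj₁ I) (sym len)))

ascValue⇐ : ∀ {n y r a} j → j + length (y ∷ r) ≡ n →
  Attainable j y a → Legal a y r → AscValue n (y ∷ r) a
ascValue⇐ {n} {y} {r} j len att g with attainable⇒reachable j att
... | p , refl , v , refl = p , valid⇒InA n _ (trans (length-++ p) len) (valid-join p y r v g) , refl

ascValue? : ∀ {n} j y r → j + length (y ∷ r) ≡ n → Decidable (AscValue n (y ∷ r))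
ascValue? j y r len a =
  map′ (λ (att , g) → ascValue⇐ j len att g) (ascValue⇒ j len) (attainable? j y a ×-dec legal? a y r)

least-below : ∀ {P : ℕ → Set} → Decidable P → ∀ i →
  (∀ a → a < i → ¬ P a) ⊎ ∃ λ m → P m × (∀ a → P a → m ≤ a)
least-below P? zero = inj₁ (λ a ())
least-below {P} P? (suc i) with least-below P? i
... | inj₂ least = inj₂ least
... | inj₁ none with P? i
...   | yes Pi = inj₂ (i , Pi , λ a Pa → ≮⇒≥ (λ a<i → none a a<i Pa))
...   | no ¬Pi = inj₁ none′
  where
  none′ : ∀ a → a < suc i → ¬ P a
  none′ a a<1+i Pa with m≤n⇒m<n∨m≡n (≤-pred a<1+i)
  ... | inj₁ a<i = none a a<i Pa
  ... | inj₂ refl = ¬Pi Pa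

least-witness : ∀ {P : ℕ → Set} → Decidable P → ∀ {c} → P c → ∃ λ m → P m × (∀ a → P a → m ≤ a)
least-witness P? {c} Pc with least-below P? (suc c)
... | inj₁ none = ⊥-elim (none c ≤-refl Pc)
... | inj₂ least = least

-- The setting of the proposition: b = b₁ ∷ bs is preceded by j + 1 entries,
-- and c₁ is a junction value of x b (so x ∈ α_A(b)).
module Junction (n j x b₁ : ℕ) (bs : List ℕ) (len : suc j + length (b₁ ∷ bs) ≡ n)
                (c₁ : ℕ) (c₁-value : AscValue n (x ∷ b₁ ∷ bs) c₁) where

  s : ℕ
  s = ascStep x b₁

  len-x : j + length (x ∷ b₁ ∷ bs) ≡ n
  len-x = trans (+-suc j _) len

  x≤c₁≤j : Attainable j x c₁
  x≤c₁≤j = proj₁ (ascValue⇒ j len-x c₁-value)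

  shift : ∀ {v} → AscValue n (x ∷ b₁ ∷ bs) v → AscValue n (b₁ ∷ bs) (v + s)
  shift av = let (att , b₁≤ , g) = ascValue⇒ j len-x av in ascValue⇐ (suc j) len (attainable-step b₁ att b₁≤) g

  -- μ_A(b) exists: the junction values of b form a decidable set containing c₁ + s.
  μ-exists : ∃ λ m → IsMu n (b₁ ∷ bs) m
  μ-exists = least-witness (ascValue? (suc j) b₁ bs len) (shift c₁-value)

  module WithMu (m : ℕ) (μ : IsMu n (b₁ ∷ bs) m) where

    b₁≤m : b₁ ≤ m
    b₁≤m = proj₁ (proj₁ (ascValue⇒ (suc j) len (proj₁ μ)))

    m-legal : Legal m b₁ bs
    m-legal = proj₂ (ascValue⇒ (suc j) len (proj₁ μ))

    lower : ∀ {v} → AscValue n (x ∷ b₁ ∷ bs) v → x ≤ v × m ≤ v + s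
    lower av = proj₁ (proj₁ (ascValue⇒ j len-x av)) , proj₂ μ _ (shift av)

    m≤c₁+s : m ≤ c₁ + s
    m≤c₁+s = proj₂ (lower c₁-value)

    candidate : ∀ {w} → x ≤ w → w ≤ c₁ → m ≤ w + s → AscValue n (x ∷ b₁ ∷ bs) w
    candidate {w} x≤w w≤c₁ m≤w+s =
      ascValue⇐ j len-x (attainable-below x≤c₁≤j x≤w w≤c₁) (b₁≤1+w , legal-mono bs m≤w+s m-legal)
      where
      b₁≤1+w : b₁ ≤ suc w
      b₁≤1+w = ≤-trans b₁≤m (≤-trans m≤w+s
                 (≤-trans (+-monoʳ-≤ w (ascStep≤1 x b₁)) (≤-reflexive (+-comm w 1))))

    -- For m ≤ x the candidate x is forced, as x bounds every value from below.
    case-above : m ≤ x → IsMu n (x ∷ b₁ ∷ bs) x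
    case-above m≤x =
      candidate ≤-refl (proj₁ x≤c₁≤j) (≤-trans m≤x (m≤m+n x s)) ,
      λ v av → proj₁ (lower av)

    -- For b₁ ≤ x there is no ascent at the junction: s = 0.
    case-between : b₁ ≤ x → x < m → IsMu n (x ∷ b₁ ∷ bs) m
    case-between b₁≤x x<m =
      candidate (<⇒≤ x<m) (drop-s m≤c₁+s) (m≤m+n m s) ,
      λ v av → drop-s (proj₂ (lower av))
      where
      drop-s : ∀ {u v} → u ≤ v + s → u ≤ v
      drop-s {u} {v} = subst (u ≤_) (+ascStep-≥ v b₁≤x)

    -- For x < b₁ the junction is an ascent: s = 1.
    case-below : x < b₁ → IsMu n (x ∷ b₁ ∷ bs) (m ∸ 1)
    case-below x<b₁ =
      candidate (∸-monoˡ-≤ 1 (<-≤-trans x<b₁ b₁≤m)) (pred-bound m≤c₁+s) (one-more (m≤n+m∸n m 1)) ,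
      λ v av → pred-bound (proj₂ (lower av))
      where
      one-more : ∀ {u v} → u ≤ suc v → u ≤ v + s
      one-more {u} {v} = subst (u ≤_) (sym (+ascStep-< v x<b₁))

      pred-bound : ∀ {v} → m ≤ v + s → m ∸ 1 ≤ v
      pred-bound {v} m≤v+s = m≤n+o⇒m∸n≤o m 1 (subst (m ≤_) (+ascStep-< v x<b₁) m≤v+s)

proposition8 : (n k : ℕ) (b₁ : ℕ) (bs : List ℕ) (x : ℕ) →
    1 ≤ k → k < n → length (b₁ ∷ bs) ≡ n ∸ k →
    Admissible n (b₁ ∷ bs) → InAlpha n (b₁ ∷ bs) x →
    (∃ λ m → IsMu n (b₁ ∷ bs) m) ×
    (∀ m → IsMu n (b₁ ∷ bs) m →
      (m ≤ x → IsMu n (x ∷ b₁ ∷ bs) x) ×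
      (b₁ ≤ x → x < m → IsMu n (x ∷ b₁ ∷ bs) m) ×
      (x < b₁ → IsMu n (x ∷ b₁ ∷ bs) (m ∸ 1)))
proposition8 n zero b₁ bs x () _ _ _ _
proposition8 n (suc j) b₁ bs x _ k<n len _ (p₁ , I₁) =
  μ-exists , λ m μ → let open WithMu m μ in case-above , case-between , case-below
  where
  open Junction n j x b₁ bs (trans (cong (suc j +_) len) (m+[n∸m]≡n (<⇒≤ k<n)))
                (asc (p₁ ++ [ x ])) (p₁ , I₁ , refl)
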